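{- Let $G$ be a finite simple graph and let $\{x,y\}\subseteq V(G)$ (with $x\neq y$) be a determining set of $G$. (i) If $\varphi\in Aut(G)$ satisfies $\varphi(x)=y$ and $\varphi(y)=x$, then every other cycle in the disjoint cycle decomposition of $\varphi$ is a 2-cycle or a fixed point. (ii) If $\varphi\in Aut(G)$ satisfies $\varphi(x)=v$, $\varphi(v)=x$ and $\varphi(y)=y$ for some vertex $v\notin\{x,y\}$, then every other cycle of $\varphi$ is a 2-cycle or a fixed point. (iii) If $\varphi\in Aut(G)$ satisfies $\varphi(y)=v$, $\varphi(v)=y$ and $\varphi(x)=x$ for some vertex $v\notin\{x,y\}$, then every other cycle of $\varphi$ is a 2-cycle or a fixed point.
   Context: A set $S\subseteq V(G)$ is a determining set if the only automorphism of $G$ fixing every vertex of $S$ is the identity. -}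

module Defs where

open import Level using (Level; suc; _⊔_)
open import Data.Nat using (ℕ; zero; suc; _<_)
open import Data.Fin using (Fin)
open import Data.Product using (_×_; Σ)
open import Data.Sum using (_⊎_)
open import Relation.Binary.PropositionalEquality using (_≡_; _≢_)
open import Relation.Nullary using (¬_; Dec)
open import Function.Bundles using (_↔_; Inverse)

record SimpleGraph (n : ℕ) : Set₁ where
  field
    Adj     : Fin n → Fin n → Set
    adj?    : ∀ u v → Dec (Adj u v)
    sym     : ∀ {u v} → Adj u v → Adj v u
    irrefl  : ∀ {u} → ¬ Adj u u

open SimpleGraph public

record Automorphism {n : ℕ} (G : SimpleGraph n) : Set where
  field
    perm     : Fin n ↔ Fin n
    preserve : ∀ u v → (Adj G u v → Adj G (Inverse.to perm u) (Inverse.to perm v))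
                     × (Adj G (Inverse.to perm u) (Inverse.to perm v) → Adj G u v)

open Automorphism public

⟦_⟧ : ∀ {n} {G : SimpleGraph n} → Automorphism G → Fin n → Fin n
⟦ φ ⟧ = Inverse.to (perm φ)

IsDeterminingPair : ∀ {n} (G : SimpleGraph n) → Fin n → Fin n → Set
IsDeterminingPair {n} G x y =
  (φ : Automorphism G) → ⟦ φ ⟧ x ≡ x → ⟦ φ ⟧ y ≡ y → ∀ v → ⟦ φ ⟧ v ≡ v

iter : ∀ {A : Set} → (A → A) → ℕ → A → A
iter f zero    a = a
iter f (suc k) a = f (iter f k a)

CycleLength : ∀ {n} → (Fin n → Fin n) → Fin n → ℕ → Set
CycleLength f w k =
  (0 < k) × (iter f k w ≡ w) × (∀ j → 0 < j → j < k → iter f j w ≢ w)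

FixedOrTransposed : ∀ {n} → (Fin n → Fin n) → Fin n → Set
FixedOrTransposed f w = CycleLength f w 1 ⊎ CycleLength f w 2

{-# OPTIONS --safe #-}
module Submission where

-- In each of the three cases φ² fixes both x and y, so φ² is the identity
-- because {x, y} is determining; thus every vertex lies in a cycle of φ of
-- length 1 or 2.

open import Defs
open import Data.Nat using (ℕ; zero; suc; s≤s; z≤n)
open import Data.Fin using (Fin; _≟_)
open import Data.Product using (_×_; _,_; proj₁; proj₂)
open import Data.Sum using (inj₁; inj₂)
open import Relation.Nullary using (yes; no)
open import Relation.Binary.PropositionalEquality using (_≡_; _≢_; trans; cong)
open import Function.Construct.Composition using (_↔-∘_)

_∘ᴬ_ : ∀ {n} {G : SimpleGraph n} → Automorphism G → Automorphism G → Automorphism G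
φ ∘ᴬ ψ = record
  { perm     = perm φ ↔-∘ perm ψ
  ; preserve = λ u v →
        (λ uv → proj₁ (preserve φ _ _) (proj₁ (preserve ψ u v) uv))
      , (λ φψuv → proj₂ (preserve ψ u v) (proj₂ (preserve φ _ _) φψuv))
  }

swap²≡id : ∀ {A : Set} (f : A → A) {a b : A} → f a ≡ b → f b ≡ a → f (f a) ≡ a
swap²≡id f fa≡b fb≡a = trans (cong f fa≡b) fb≡a

f²w≡w⇒fixedOrTransposed : ∀ {n} (f : Fin n → Fin n) w → f (f w) ≡ w →
                          FixedOrTransposed f w
f²w≡w⇒fixedOrTransposed f w f²w≡w with f w ≟ w
... | yes fw≡w = inj₁ (s≤s z≤n , fw≡w , λ { (suc j) _ (s≤s ()) })
... | no  fw≢w = inj₂ (s≤s z≤n , f²w≡w , λ { (suc zero) _ _ → fw≢w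
                                           ; (suc (suc j)) _ (s≤s (s≤s ())) })

determiningPair⇒square-fixing-pair-is-involution :
  ∀ {n} {G : SimpleGraph n} {x y : Fin n} → IsDeterminingPair G x y →
  (φ : Automorphism G) → ⟦ φ ⟧ (⟦ φ ⟧ x) ≡ x → ⟦ φ ⟧ (⟦ φ ⟧ y) ≡ y →
  ∀ w → FixedOrTransposed ⟦ φ ⟧ w
determiningPair⇒square-fixing-pair-is-involution det φ φ²x≡x φ²y≡y w =
  f²w≡w⇒fixedOrTransposed ⟦ φ ⟧ w (det (φ ∘ᴬ φ) φ²x≡x φ²y≡y w)

proposition4 : ∀ {n : ℕ} (G : SimpleGraph n) (x y : Fin n) → x ≢ y →
      IsDeterminingPair G x y →
      ((φ : Automorphism G) → ⟦ φ ⟧ x ≡ y → ⟦ φ ⟧ y ≡ x →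
        ∀ w → w ≢ x → w ≢ y → FixedOrTransposed ⟦ φ ⟧ w)
      × ((φ : Automorphism G) (v : Fin n) → v ≢ x → v ≢ y →
          ⟦ φ ⟧ x ≡ v → ⟦ φ ⟧ v ≡ x → ⟦ φ ⟧ y ≡ y →
          ∀ w → w ≢ x → w ≢ v → w ≢ y → FixedOrTransposed ⟦ φ ⟧ w)
      × ((φ : Automorphism G) (v : Fin n) → v ≢ x → v ≢ y →
          ⟦ φ ⟧ y ≡ v → ⟦ φ ⟧ v ≡ y → ⟦ φ ⟧ x ≡ x →
          ∀ w → w ≢ x → w ≢ y → w ≢ v → FixedOrTransposed ⟦ φ ⟧ w)
proposition4 G x y _ det =
    (λ φ φx≡y φy≡x w _ _ →
       involutive φ (swap²≡id ⟦ φ ⟧ φx≡y φy≡x) (swap²≡id ⟦ φ ⟧ φy≡x φx≡y) w)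
  , (λ φ v _ _ φx≡v φv≡x φy≡y w _ _ _ →
       involutive φ (swap²≡id ⟦ φ ⟧ φx≡v φv≡x) (swap²≡id ⟦ φ ⟧ φy≡y φy≡y) w)
  , (λ φ v _ _ φy≡v φv≡y φx≡x w _ _ _ →
       involutive φ (swap²≡id ⟦ φ ⟧ φx≡x φx≡x) (swap²≡id ⟦ φ ⟧ φy≡v φv≡y) w)
  where
    involutive : (φ : Automorphism G) → ⟦ φ ⟧ (⟦ φ ⟧ x) ≡ x → ⟦ φ ⟧ (⟦ φ ⟧ y) ≡ y →
                 ∀ w → FixedOrTransposed ⟦ φ ⟧ w
    involutive = determiningPair⇒square-fixing-pair-is-involution det
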